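{- Let $(m,n)\in\mathbb Z_{>0}\times\mathbb Z$ be coprime and $d>0$ an integer. Then $$\sum_{i=1}^{dm}(i-1)\,\mathbf b(dm,dn)_i=\tfrac12 d(dmn-m-n+1).$$
   Context: For $(M,N)\in\mathbb Z_{>0}\times\mathbb Z$, $\mathbf b(M,N)\in\mathbb Z^M$ is defined by $\mathbf b(M,N)_i=\lceil iN/M\rceil-\lceil(i-1)N/M\rceil$ for $i=1,\dots,M$. -}

module Defs where

open import Data.Nat as ℕ using (ℕ; zero; suc; NonZero)
open import Data.Integer using (ℤ; +_; -_; _+_; _-_; _*_; _/ℕ_; 0ℤ)

ceilDiv : ℤ → (M : ℕ) → .{{NonZero M}} → ℤ
ceilDiv x M = - ((- x) /ℕ M)

-- b(M,N)_i = ⌈iN/M⌉ - ⌈(i-1)N/M⌉   (i a natural number, meaningful for 1 ≤ i ≤ M)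
b : (M : ℕ) → .{{NonZero M}} → ℤ → ℕ → ℤ
b M N i = ceilDiv (+ i * N) M - ceilDiv (+ (i ℕ.∸ 1) * N) M

sum1to : ℕ → (ℕ → ℤ) → ℤ
sum1to zero    f = 0ℤ
sum1to (suc k) f = sum1to k f + f (suc k)

-- Since b(dm,dn)_i = ⌈in/m⌉ - ⌈(i-1)n/m⌉, summation by parts turns the sum into
-- dm·dn - Σ_{i≤dm} ⌈in/m⌉.  As ⌈(m+i)n/m⌉ = n + ⌈in/m⌉, that sum is made of d shifted
-- copies of one period, and over one period coprimality pairs i with m - i so that
-- ⌈in/m⌉ + ⌈(m-i)n/m⌉ = n + 1; hence 2·Σ_{i≤m} ⌈in/m⌉ = mn + m + n - 1.
module Submission where

open import Defs
open import Data.Nat as ℕ using (ℕ; zero; suc; NonZero; z<s; s<s)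
open import Data.Nat.Properties using (m*n≢0)
open import Data.Integer using (ℤ; +_; _+_; _-_; _*_; 1ℤ)
open import Data.Integer.Coprimality using (Coprime)
open import Relation.Binary.PropositionalEquality using (_≡_)

open import Data.Empty using (⊥-elim)
open import Data.Integer using (-_; 0ℤ; -[1+_]; +[1+_]; _/ℕ_; _%ℕ_; ∣_∣)
open import Data.Integer.Coprimality using (coprime-divisor)
open import Data.Integer.DivMod using (a≡a%ℕn+[a/ℕn]*n; n%ℕd<d)
open import Data.Integer.Divisibility using (_∣_)
open import Data.Integer.Properties using
  (pos-+; pos-*; +-injective; abs-*; +-identityˡ; +-identityʳ; +-assoc; +-comm; *-comm; i-j≡0⇒i≡j; m-n≡m⊖n; ⊖-≥)
open import Data.Integer.Tactic.RingSolver using (solve-∀)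
import Data.Nat.Properties as ℕ
open import Data.Nat.Divisibility using (divides; ∣⇒≤)
open import Relation.Binary.PropositionalEquality using (refl; sym; trans; cong; cong₂; subst; module ≡-Reasoning)
open import Relation.Nullary using (¬_)

open ≡-Reasoning

pos-∸ : ∀ {m n} → n ℕ.≤ m → + (m ℕ.∸ n) ≡ + m - + n
pos-∸ {m} {n} n≤m = sym (trans (m-n≡m⊖n m n) (⊖-≥ n≤m))

ceilRem : ℤ → (M : ℕ) → .{{NonZero M}} → ℕ
ceilRem x M = (- x) %ℕ M

ceilRem<M : ∀ x M .{{_ : NonZero M}} → ceilRem x M ℕ.< M
ceilRem<M x M = n%ℕd<d (- x) M

x+ceilRem≡ceilDiv*M : ∀ x M .{{_ : NonZero M}} → x + + ceilRem x M ≡ ceilDiv x M * + M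
x+ceilRem≡ceilDiv*M x M = begin
  x + r                ≡⟨ double-neg x r ⟩
  - (- x) + r          ≡⟨ cong (λ y → - y + r) (a≡a%ℕn+[a/ℕn]*n (- x) M) ⟩
  - (r + f * + M) + r  ≡⟨ cancel r f (+ M) ⟩
  (- f) * + M          ∎
  where
  r = + ceilRem x M
  f = (- x) /ℕ M
  double-neg : ∀ x r → x + r ≡ - (- x) + r
  double-neg = solve-∀
  cancel : ∀ r f M → - (r + f * M) + r ≡ (- f) * M
  cancel = solve-∀

<⇒≢+positive-multiple : ∀ {M r} s t → r ℕ.< M → ¬ (+ r ≡ + s + +[1+ t ] * + M)
<⇒≢+positive-multiple {M} {r} s t r<M eq = ℕ.<⇒≱ r<M M≤r
  where
  r≡s+[1+t]M : r ≡ s ℕ.+ suc t ℕ.* M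
  r≡s+[1+t]M = +-injective (trans eq (cong (λ z → + s + z) (sym (pos-* (suc t) M))))
  M≤r : M ℕ.≤ r
  M≤r = ℕ.≤-trans (ℕ.m≤n*m M (suc t))
          (ℕ.≤-trans (ℕ.m≤n+m (suc t ℕ.* M) s) (ℕ.≤-reflexive (sym r≡s+[1+t]M)))

multiple-below⇒0 : ∀ {M r s} k → r ℕ.< M → s ℕ.< M → + r ≡ + s + k * + M → k ≡ 0ℤ
multiple-below⇒0             (+ zero)  _   _   _  = refl
multiple-below⇒0     {s = s} +[1+ t ] r<M _   eq = ⊥-elim (<⇒≢+positive-multiple s t r<M eq)
multiple-below⇒0 {M} {r} {s} -[1+ t ] _   s<M eq = ⊥-elim (<⇒≢+positive-multiple r t s<M (begin
  + s                                    ≡⟨ move (+ s) (+[1+ t ]) (+ M) ⟩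
  + s + -[1+ t ] * + M + +[1+ t ] * + M  ≡⟨ cong (_+ +[1+ t ] * + M) (sym eq) ⟩
  + r + +[1+ t ] * + M                   ∎))
  where
  move : ∀ s u M → s ≡ s + (- u) * M + u * M
  move = solve-∀

ceilDiv-unique : ∀ x M .{{_ : NonZero M}} q {r} → r ℕ.< M → x + + r ≡ q * + M → ceilDiv x M ≡ q
ceilDiv-unique x M q {r} r<M x+r≡qM =
  i-j≡0⇒i≡j c q (multiple-below⇒0 (c - q) (ceilRem<M x M) r<M (begin
    + s                            ≡⟨ rearrange x (+ s) (+ r) ⟩
    + r + (x + + s) - (x + + r)    ≡⟨ cong₂ (λ y z → + r + y - z) (x+ceilRem≡ceilDiv*M x M) x+r≡qM ⟩
    + r + c * + M - q * + M        ≡⟨ collect (+ r) c q (+ M) ⟩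
    + r + (c - q) * + M            ∎))
  where
  c = ceilDiv x M
  s = ceilRem x M
  rearrange : ∀ x s r → s ≡ r + (x + s) - (x + r)
  rearrange = solve-∀
  collect : ∀ r c q M → r + c * M - q * M ≡ r + (c - q) * M
  collect = solve-∀

ceilDiv-+-multiple : ∀ k x M .{{_ : NonZero M}} → ceilDiv (k * + M + x) M ≡ k + ceilDiv x M
ceilDiv-+-multiple k x M = ceilDiv-unique (k * + M + x) M (k + c) (ceilRem<M x M) (begin
  k * + M + x + + ceilRem x M   ≡⟨ +-assoc (k * + M) x _ ⟩
  k * + M + (x + + ceilRem x M) ≡⟨ cong (λ y → k * + M + y) (x+ceilRem≡ceilDiv*M x M) ⟩
  k * + M + c * + M             ≡⟨ distrib k c (+ M) ⟩
  (k + c) * + M                 ∎)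
  where
  c = ceilDiv x M
  distrib : ∀ k c M → k * M + c * M ≡ (k + c) * M
  distrib = solve-∀

ceilDiv-multiple : ∀ k M .{{_ : NonZero M}} → ceilDiv (k * + M) M ≡ k
ceilDiv-multiple k M = ceilDiv-unique (k * + M) M k (ℕ.>-nonZero⁻¹ M) (+-identityʳ (k * + M))

ceilDiv-scale : ∀ d .{{_ : NonZero d}} x M .{{_ : NonZero M}} →
  ceilDiv (+ d * x) (d ℕ.* M) {{m*n≢0 d M}} ≡ ceilDiv x M
ceilDiv-scale d x M = ceilDiv-unique (+ d * x) (d ℕ.* M) {{m*n≢0 d M}} c
  (ℕ.*-monoʳ-< d (ceilRem<M x M)) (begin
    + d * x + + (d ℕ.* r)  ≡⟨ cong (λ y → + d * x + y) (pos-* d r) ⟩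
    + d * x + + d * + r    ≡⟨ factor (+ d) x (+ r) ⟩
    + d * (x + + r)        ≡⟨ cong (+ d *_) (x+ceilRem≡ceilDiv*M x M) ⟩
    + d * (c * + M)        ≡⟨ swap (+ d) c (+ M) ⟩
    c * (+ d * + M)        ≡⟨ cong (c *_) (sym (pos-* d M)) ⟩
    c * + (d ℕ.* M)        ∎)
  where
  c = ceilDiv x M
  r = ceilRem x M
  factor : ∀ d x r → d * x + d * r ≡ d * (x + r)
  factor = solve-∀
  swap : ∀ d c M → d * (c * M) ≡ c * (d * M)
  swap = solve-∀

ceilDiv-+-ceilDiv-neg : ∀ x M .{{_ : NonZero M}} → ¬ (+ M ∣ x) → ceilDiv x M + ceilDiv (- x) M ≡ 1ℤ
ceilDiv-+-ceilDiv-neg x M M∤x = from-rem (ceilRem x M) (ceilRem<M x M) (x+ceilRem≡ceilDiv*M x M)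
  where
  c = ceilDiv x M
  from-rem : ∀ r → r ℕ.< M → x + + r ≡ c * + M → c + ceilDiv (- x) M ≡ 1ℤ
  from-rem zero _ x+0≡cM = ⊥-elim (M∤x (divides ∣ c ∣ (begin
    ∣ x ∣           ≡⟨ cong ∣_∣ (trans (sym (+-identityʳ x)) x+0≡cM) ⟩
    ∣ c * + M ∣     ≡⟨ abs-* c (+ M) ⟩
    ∣ c ∣ ℕ.* M     ∎)))
  from-rem (suc r) r<M x+r≡cM = begin
    c + ceilDiv (- x) M  ≡⟨ cong (λ y → c + y) (ceilDiv-unique (- x) M (1ℤ - c) M∸r<M -x+[M∸r]≡[1-c]M) ⟩
    c + (1ℤ - c)         ≡⟨ cancel c ⟩
    1ℤ                   ∎
    where
    cancel : ∀ c → c + (1ℤ - c) ≡ 1ℤ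
    cancel = solve-∀
    rearrange : ∀ x M R → - x + (M - R) ≡ M - (x + R)
    rearrange = solve-∀
    factor : ∀ c M → M - c * M ≡ (1ℤ - c) * M
    factor = solve-∀
    M∸r<M : M ℕ.∸ suc r ℕ.< M
    M∸r<M = ℕ.∸-monoʳ-< z<s (ℕ.<⇒≤ r<M)
    -x+[M∸r]≡[1-c]M : - x + + (M ℕ.∸ suc r) ≡ (1ℤ - c) * + M
    -x+[M∸r]≡[1-c]M = begin
      - x + + (M ℕ.∸ suc r)     ≡⟨ cong (λ y → - x + y) (pos-∸ (ℕ.<⇒≤ r<M)) ⟩
      - x + (+ M - + suc r)     ≡⟨ rearrange x (+ M) (+ suc r) ⟩
      + M - (x + + suc r)       ≡⟨ cong (λ y → + M - y) x+r≡cM ⟩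
      + M - c * + M             ≡⟨ factor c (+ M) ⟩
      (1ℤ - c) * + M            ∎

coprime⇒∤ : ∀ {m n} j .{{_ : NonZero j}} → Coprime (+ m) n → j ℕ.< m → ¬ (+ m ∣ + j * n)
coprime⇒∤ {m} {n} j coprime j<m m∣jn =
  ℕ.<⇒≱ j<m (∣⇒≤ (coprime-divisor (+ m) n (+ j) coprime (subst (+ m ∣_) (*-comm (+ j) n) m∣jn)))

ceilDiv-period : ∀ m .{{_ : NonZero m}} n j → ceilDiv (+ (m ℕ.+ j) * n) m ≡ n + ceilDiv (+ j * n) m
ceilDiv-period m n j = trans (cong (λ y → ceilDiv y m) expand) (ceilDiv-+-multiple n (+ j * n) m)
  where
  distrib : ∀ m j n → (m + j) * n ≡ n * m + j * n
  distrib = solve-∀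
  expand : + (m ℕ.+ j) * n ≡ n * + m + + j * n
  expand = trans (cong (_* n) (pos-+ m j)) (distrib (+ m) (+ j) n)

ceilDiv-reflect : ∀ m .{{_ : NonZero m}} n → Coprime (+ m) n → ∀ j .{{_ : NonZero j}} → j ℕ.< m →
  ceilDiv (+ j * n) m + ceilDiv (+ (m ℕ.∸ j) * n) m ≡ n + 1ℤ
ceilDiv-reflect m n coprime j j<m = begin
  c + ceilDiv (+ (m ℕ.∸ j) * n) m     ≡⟨ cong (λ y → c + ceilDiv y m) reflect ⟩
  c + ceilDiv (n * + m + - x) m       ≡⟨ cong (λ y → c + y) (ceilDiv-+-multiple n (- x) m) ⟩
  c + (n + ceilDiv (- x) m)           ≡⟨ swap c n (ceilDiv (- x) m) ⟩
  n + (c + ceilDiv (- x) m)           ≡⟨ cong (λ y → n + y) (ceilDiv-+-ceilDiv-neg x m (coprime⇒∤ j coprime j<m)) ⟩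
  n + 1ℤ                              ∎
  where
  x = + j * n
  c = ceilDiv x m
  swap : ∀ a b c → a + (b + c) ≡ b + (a + c)
  swap = solve-∀
  distrib : ∀ m j n → (m - j) * n ≡ n * m + - (j * n)
  distrib = solve-∀
  reflect : + (m ℕ.∸ j) * n ≡ n * + m + - x
  reflect = trans (cong (_* n) (pos-∸ (ℕ.<⇒≤ j<m))) (distrib (+ m) (+ j) n)

sum1to-cong : ∀ k {f g : ℕ → ℤ} → (∀ {j} → j ℕ.< k → f (suc j) ≡ g (suc j)) → sum1to k f ≡ sum1to k g
sum1to-cong zero    f≗g = refl
sum1to-cong (suc k) f≗g = cong₂ _+_ (sum1to-cong k (λ j<k → f≗g (ℕ.m<n⇒m<1+n j<k))) (f≗g (ℕ.n<1+n k))

sum1to-+ : ∀ k (f g : ℕ → ℤ) → sum1to k (λ j → f j + g j) ≡ sum1to k f + sum1to k g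
sum1to-+ zero    f g = refl
sum1to-+ (suc k) f g = begin
  sum1to k (λ j → f j + g j) + (f (suc k) + g (suc k))
    ≡⟨ cong (_+ (f (suc k) + g (suc k))) (sum1to-+ k f g) ⟩
  sum1to k f + sum1to k g + (f (suc k) + g (suc k))
    ≡⟨ interchange (sum1to k f) (sum1to k g) (f (suc k)) (g (suc k)) ⟩
  sum1to k f + f (suc k) + (sum1to k g + g (suc k))
    ∎
  where
  interchange : ∀ a b c d → a + b + (c + d) ≡ a + c + (b + d)
  interchange = solve-∀

sum1to-const : ∀ k a → sum1to k (λ _ → a) ≡ + k * a
sum1to-const zero    a = refl
sum1to-const (suc k) a = trans (cong (_+ a) (sum1to-const k a)) (step (+ k) a)
  where
  step : ∀ k a → k * a + a ≡ (1ℤ + k) * a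
  step = solve-∀

sum1to-suc : ∀ k (f : ℕ → ℤ) → sum1to (suc k) f ≡ f 1 + sum1to k (λ j → f (suc j))
sum1to-suc zero    f = trans (+-identityˡ (f 1)) (sym (+-identityʳ (f 1)))
sum1to-suc (suc k) f = begin
  sum1to (suc k) f + f (suc (suc k))                      ≡⟨ cong (_+ f (suc (suc k))) (sum1to-suc k f) ⟩
  f 1 + sum1to k (λ j → f (suc j)) + f (suc (suc k))      ≡⟨ +-assoc (f 1) _ _ ⟩
  f 1 + sum1to (suc k) (λ j → f (suc j))                  ∎

sum1to-reverse : ∀ k (f : ℕ → ℤ) → sum1to k f ≡ sum1to k (λ j → f (suc k ℕ.∸ j))
sum1to-reverse zero    f = refl
sum1to-reverse (suc k) f = begin
  sum1to k f + f (suc k)                                   ≡⟨ cong (_+ f (suc k)) (sum1to-reverse k f) ⟩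
  sum1to k (λ j → f (suc k ℕ.∸ j)) + f (suc k)             ≡⟨ +-comm _ (f (suc k)) ⟩
  f (suc k) + sum1to k (λ j → f (suc k ℕ.∸ j))             ≡⟨ sym (sum1to-suc k (λ j → f (suc (suc k) ℕ.∸ j))) ⟩
  sum1to (suc k) (λ j → f (suc (suc k) ℕ.∸ j))             ∎

sum1to-split : ∀ a b (f : ℕ → ℤ) → sum1to (a ℕ.+ b) f ≡ sum1to a f + sum1to b (λ j → f (a ℕ.+ j))
sum1to-split zero    b f = sym (+-identityˡ (sum1to b f))
sum1to-split (suc a) b f = begin
  sum1to (suc (a ℕ.+ b)) f
    ≡⟨ sum1to-suc (a ℕ.+ b) f ⟩
  f 1 + sum1to (a ℕ.+ b) f′
    ≡⟨ cong (λ y → f 1 + y) (sum1to-split a b f′) ⟩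
  f 1 + (sum1to a f′ + tail)
    ≡⟨ sym (+-assoc (f 1) (sum1to a f′) tail) ⟩
  f 1 + sum1to a f′ + tail
    ≡⟨ cong (_+ tail) (sym (sum1to-suc a f)) ⟩
  sum1to (suc a) f + tail
    ∎
  where
  f′ : ℕ → ℤ
  f′ j = f (suc j)
  tail = sum1to b (λ j → f (suc a ℕ.+ j))

sum1to-by-parts : ∀ k (C : ℕ → ℤ) →
  sum1to k (λ i → + (i ℕ.∸ 1) * (C i - C (i ℕ.∸ 1))) ≡ + k * C k - sum1to k C
sum1to-by-parts zero    C = refl
sum1to-by-parts (suc k) C = trans (cong (_+ + k * (C (suc k) - C k)) (sum1to-by-parts k C))
                                  (step (+ k) (C k) (C (suc k)) (sum1to k C))
  where
  step : ∀ k a b S → k * a - S + k * (b - a) ≡ (1ℤ + k) * b - (S + b)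
  step = solve-∀

twice-sum-ceilDiv-period : ∀ m .{{_ : NonZero m}} n → Coprime (+ m) n →
  + 2 * sum1to m (λ j → ceilDiv (+ j * n) m) ≡ + m * n + + m + n - 1ℤ
twice-sum-ceilDiv-period m@(suc k) n coprime = begin
  + 2 * (S + C m)                                      ≡⟨ cong (λ y → + 2 * (S + y)) Cm≡n ⟩
  + 2 * (S + n)                                        ≡⟨ double S n ⟩
  S + S + + 2 * n                                      ≡⟨ cong (λ y → S + y + + 2 * n) (sum1to-reverse k C) ⟩
  S + sum1to k (λ j → C (m ℕ.∸ j)) + + 2 * n           ≡⟨ cong (_+ + 2 * n) (sym (sum1to-+ k C (λ j → C (m ℕ.∸ j)))) ⟩
  sum1to k (λ j → C j + C (m ℕ.∸ j)) + + 2 * n         ≡⟨ cong (_+ + 2 * n) (sum1to-cong k pair) ⟩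
  sum1to k (λ _ → n + 1ℤ) + + 2 * n                    ≡⟨ cong (_+ + 2 * n) (sum1to-const k (n + 1ℤ)) ⟩
  + k * (n + 1ℤ) + + 2 * n                             ≡⟨ collect (+ k) n ⟩
  (1ℤ + + k) * n + (1ℤ + + k) + n - 1ℤ                 ∎
  where
  C : ℕ → ℤ
  C j = ceilDiv (+ j * n) m
  S = sum1to k C
  Cm≡n : C m ≡ n
  Cm≡n = trans (cong (λ y → ceilDiv y m) (*-comm (+ m) n)) (ceilDiv-multiple n m)
  pair : ∀ {j} → j ℕ.< k → C (suc j) + C (m ℕ.∸ suc j) ≡ n + 1ℤ
  pair j<k = ceilDiv-reflect m n coprime (suc _) (s<s j<k)
  double : ∀ S n → + 2 * (S + n) ≡ S + S + + 2 * n
  double = solve-∀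
  collect : ∀ k n → k * (n + 1ℤ) + + 2 * n ≡ (1ℤ + k) * n + (1ℤ + k) + n - 1ℤ
  collect = solve-∀

twice-sum-ceilDiv : ∀ m .{{_ : NonZero m}} n → Coprime (+ m) n → ∀ d →
  + 2 * sum1to (d ℕ.* m) (λ j → ceilDiv (+ j * n) m) ≡ + d * (+ d * + m * n + + m + n - 1ℤ)
twice-sum-ceilDiv m n coprime zero    = refl
twice-sum-ceilDiv m n coprime (suc d) = begin
  + 2 * sum1to (m ℕ.+ d ℕ.* m) C                                  ≡⟨ cong (+ 2 *_) (sum1to-split m (d ℕ.* m) C) ⟩
  + 2 * (S₁ + sum1to (d ℕ.* m) (λ j → C (m ℕ.+ j)))                ≡⟨ cong (λ y → + 2 * (S₁ + y)) shifted ⟩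
  + 2 * (S₁ + (+ d * + m * n + S))                                 ≡⟨ expand S₁ S (+ d) (+ m) n ⟩
  + 2 * S₁ + + 2 * (+ d * + m * n) + + 2 * S                       ≡⟨ cong₂ (λ y z → y + + 2 * (+ d * + m * n) + z)
                                                                            (twice-sum-ceilDiv-period m n coprime)
                                                                            (twice-sum-ceilDiv m n coprime d) ⟩
  + m * n + + m + n - 1ℤ + + 2 * (+ d * + m * n)
    + + d * (+ d * + m * n + + m + n - 1ℤ)                         ≡⟨ collect (+ d) (+ m) n ⟩
  (1ℤ + + d) * ((1ℤ + + d) * + m * n + + m + n - 1ℤ)              ∎
  where
  C : ℕ → ℤ
  C j = ceilDiv (+ j * n) m
  S₁ = sum1to m C
  S = sum1to (d ℕ.* m) C
  shifted : sum1to (d ℕ.* m) (λ j → C (m ℕ.+ j)) ≡ + d * + m * n + S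
  shifted = begin
    sum1to (d ℕ.* m) (λ j → C (m ℕ.+ j))   ≡⟨ sum1to-cong (d ℕ.* m) (λ _ → ceilDiv-period m n _) ⟩
    sum1to (d ℕ.* m) (λ j → n + C j)       ≡⟨ sum1to-+ (d ℕ.* m) (λ _ → n) C ⟩
    sum1to (d ℕ.* m) (λ _ → n) + S         ≡⟨ cong (_+ S) (sum1to-const (d ℕ.* m) n) ⟩
    + (d ℕ.* m) * n + S                    ≡⟨ cong (λ y → y * n + S) (pos-* d m) ⟩
    + d * + m * n + S                      ∎
  expand : ∀ S₁ S d m n → + 2 * (S₁ + (d * m * n + S)) ≡ + 2 * S₁ + + 2 * (d * m * n) + + 2 * S
  expand = solve-∀
  collect : ∀ d m n → m * n + m + n - 1ℤ + + 2 * (d * m * n) + d * (d * m * n + m + n - 1ℤ)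
                      ≡ (1ℤ + d) * ((1ℤ + d) * m * n + m + n - 1ℤ)
  collect = solve-∀

b-dilate : ∀ d .{{_ : NonZero d}} M .{{_ : NonZero M}} N i →
  b (d ℕ.* M) {{m*n≢0 d M}} (+ d * N) i ≡ ceilDiv (+ i * N) M - ceilDiv (+ (i ℕ.∸ 1) * N) M
b-dilate d M N i = cong₂ _-_ (dilate i) (dilate (i ℕ.∸ 1))
  where
  swap : ∀ j d N → j * (d * N) ≡ d * (j * N)
  swap = solve-∀
  dilate : ∀ j → ceilDiv (+ j * (+ d * N)) (d ℕ.* M) {{m*n≢0 d M}} ≡ ceilDiv (+ j * N) M
  dilate j = trans (cong (λ y → ceilDiv y (d ℕ.* M) {{m*n≢0 d M}}) (swap (+ j) (+ d) N))
                   (ceilDiv-scale d (+ j * N) M)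

lemma8p11 : (m : ℕ) .{{_ : NonZero m}} (n : ℤ) (d : ℕ) .{{_ : NonZero d}} →
    Coprime (+ m) n →
    + 2 * sum1to (d ℕ.* m) (λ i → + (i ℕ.∸ 1) * b (d ℕ.* m) {{m*n≢0 d m}} (+ d * n) i)
      ≡ + d * (+ d * + m * n - + m - n + 1ℤ)
lemma8p11 m n d coprime = begin
  + 2 * sum1to (d ℕ.* m) (λ i → + (i ℕ.∸ 1) * b (d ℕ.* m) {{m*n≢0 d m}} (+ d * n) i)
    ≡⟨ cong (+ 2 *_) (sum1to-cong (d ℕ.* m) (λ {i} _ → cong (+ i *_) (b-dilate d m n (suc i)))) ⟩
  + 2 * sum1to (d ℕ.* m) (λ i → + (i ℕ.∸ 1) * (C i - C (i ℕ.∸ 1)))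
    ≡⟨ cong (+ 2 *_) (sum1to-by-parts (d ℕ.* m) C) ⟩
  + 2 * (+ (d ℕ.* m) * C (d ℕ.* m) - S)
    ≡⟨ cong (λ y → + 2 * (y - S)) (cong₂ _*_ (pos-* d m) Cdm≡dn) ⟩
  + 2 * (+ d * + m * (+ d * n) - S)
    ≡⟨ distrib (+ d * + m * (+ d * n)) S ⟩
  + 2 * (+ d * + m * (+ d * n)) - + 2 * S
    ≡⟨ cong (λ y → + 2 * (+ d * + m * (+ d * n)) - y) (twice-sum-ceilDiv m n coprime d) ⟩
  + 2 * (+ d * + m * (+ d * n)) - + d * (+ d * + m * n + + m + n - 1ℤ)
    ≡⟨ collect (+ d) (+ m) n ⟩
  + d * (+ d * + m * n - + m - n + 1ℤ) ∎
  where
  C : ℕ → ℤ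
  C j = ceilDiv (+ j * n) m
  S = sum1to (d ℕ.* m) C
  reorder : ∀ d m n → d * m * n ≡ d * n * m
  reorder = solve-∀
  Cdm≡dn : C (d ℕ.* m) ≡ + d * n
  Cdm≡dn = trans (cong (λ y → ceilDiv y m) (trans (cong (_* n) (pos-* d m)) (reorder (+ d) (+ m) n)))
                 (ceilDiv-multiple (+ d * n) m)
  distrib : ∀ x S → + 2 * (x - S) ≡ + 2 * x - + 2 * S
  distrib = solve-∀
  collect : ∀ d m n → + 2 * (d * m * (d * n)) - d * (d * m * n + m + n - 1ℤ) ≡ d * (d * m * n - m - n + 1ℤ)
  collect = solve-∀
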